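{- Suppose $x\in\mathcal{P}_1$ is a fixed point of a morphism $\tau:\mathbb{A}^+\to\mathbb{A}^+$. Then there exists a morphism $\tau':\{1,2,\dots,n_x\}^+\to\{1,2,\dots,n_x\}^+$ fixing $\delta(x)$ such that $\phi\circ\tau'=\tau\circ\phi$.
   Context: $x$ is an infinite word over a finite alphabet $\mathbb{A}$. A finite non-empty word is unbordered if no non-empty word other than itself is both a prefix and a suffix of it; $UP(x)$ is the set of non-empty unbordered prefixes of $x$. $\mathcal{P}_1$ is the set of infinite words admitting a prefixal factorization (a factorization $x=V_0V_1\cdots$ with each $V_i$ a non-empty prefix of $x$); each $x\in\mathcal{P}_1$ has a unique factorization $x=U_0U_1\cdots$ with $U_i\in UP(x)$. With $UP'(x)=\{U_i:i\ge0\}$, $n_x=\mathrm{card}(UP'(x))$, $UP'(x)$ ordered by index of first occurrence in this factorization, and $\phi:\{1,\dots,n_x\}\to UP'(x)$ the order-preserving bijection (extended to a morphism on $\{1,\dots,n_x\}^+$), the derived word is $\delta(x)=\phi^{ -1}(U_0)\phi^{ -1}(U_1)\cdots$. -}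

module Defs where

open import Data.Nat using (ℕ; zero; suc; _<_)
open import Data.Fin using (Fin)
import Data.Fin as Fin
open import Data.List using (List; []; _∷_; _++_; map; upTo; length; filter; concatMap)
open import Data.List.NonEmpty using (List⁺; toList)
open import Data.List.Properties using (≡-dec)
open import Data.List.Relation.Unary.Any using (any?)
open import Data.Product using (Σ; ∃; _×_)
open import Data.Empty using (⊥)
open import Relation.Nullary using (¬_; Dec; yes; no)
open import Relation.Binary.PropositionalEquality using (_≡_; _≢_)

-- Infinite words over the finite alphabet Fin m (any finite alphabet, up to renaming).
InfWord : Set → Set
InfWord A = ℕ → A

pre : {A : Set} → ℕ → InfWord A → List A
pre n x = map x (upTo n)

IsPrefix : {A : Set} → List A → InfWord A → Set
IsPrefix w x = w ≡ pre (length w) x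

cat : {A : Set} → (ℕ → List⁺ A) → ℕ → List A
cat w zero    = []
cat w (suc n) = cat w n ++ toList (w n)

FactorsAs : {A : Set} → InfWord A → (ℕ → List⁺ A) → Set
FactorsAs x w = ∀ n → IsPrefix (cat w n) x

Unbordered : {A : Set} → List A → Set
Unbordered w = (w ≢ []) ×
  (∀ u → u ≢ [] → u ≢ w → (∃ λ v → u ++ v ≡ w) → (∃ λ v → v ++ u ≡ w) → ⊥)

InP1 : {A : Set} → InfWord A → Set
InP1 x = Σ (ℕ → List⁺ _) λ V → (∀ i → IsPrefix (toList (V i)) x) × FactorsAs x V

IsUPFactorization : {A : Set} → InfWord A → (ℕ → List⁺ A) → Set
IsUPFactorization x U =
  FactorsAs x U × (∀ i → IsPrefix (toList (U i)) x × Unbordered (toList (U i)))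

applyM : {A B : Set} → (A → List⁺ B) → List A → List B
applyM f w = concatMap (λ a → toList (f a)) w

IsFixedPoint : {A : Set} → (A → List⁺ A) → InfWord A → Set
IsFixedPoint τ x = FactorsAs x (λ i → τ (x i))

eqW : {m : ℕ} → (u v : List⁺ (Fin m)) → Dec (toList u ≡ toList v)
eqW u v = ≡-dec Fin._≟_ (toList u) (toList v)

firstFrom : {m : ℕ} → (ℕ → List⁺ (Fin m)) → List⁺ (Fin m) → ℕ → List ℕ → ℕ
firstFrom U w d []       = d
firstFrom U w d (j ∷ js) with eqW (U j) w
... | yes _ = j
... | no  _ = firstFrom U w d js

firstOcc : {m : ℕ} → (ℕ → List⁺ (Fin m)) → ℕ → ℕ
firstOcc U i = firstFrom U (U i) i (upTo (suc i))

IsNew : {m : ℕ} → (ℕ → List⁺ (Fin m)) → ℕ → Set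
IsNew U j = ¬ Data.List.Relation.Unary.Any.Any (λ k → toList (U k) ≡ toList (U j)) (upTo j)

isNew? : {m : ℕ} → (U : ℕ → List⁺ (Fin m)) → (j : ℕ) → Dec (IsNew U j)
isNew? U j with any? (λ k → eqW (U k) (U j)) (upTo j)
... | yes p = no (λ q → q p)
... | no ¬p = yes ¬p

-- derived word δ(x) (0-based letters: letter k stands for k+1 in the paper):
-- δ i = number of distinct words first occurring before the first occurrence of U i.
derived : {m : ℕ} → (ℕ → List⁺ (Fin m)) → ℕ → ℕ
derived U i = length (filter (isNew? U) (upTo (firstOcc U i)))

-- letter k belongs to the derived alphabet {0,…,n_x - 1} (i.e. occurs in δ(x))
InDerivedAlphabet : (ℕ → ℕ) → ℕ → Set
InDerivedAlphabet δ k = ∃ λ i → δ i ≡ k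

-- Since x = τ(x) and every Uᵢ is a prefix of x, τ(Uᵢ) is again a prefix of x, and it occurs
-- where τ(U₀⋯Uᵢ₋₁) ends. Every finite prefix of x factors into unbordered prefixes (split off
-- the shortest border), so the factorizations of τ(U₀), τ(U₁), … concatenate to a second
-- factorization of x into unbordered prefixes. It coincides with U₀U₁⋯, because a factor that
-- overlaps the end of a longer unbordered factor would be a border of it. Hence τ(Uᵢ) is a block
-- U_{Nᵢ}⋯U_{Nᵢ₊₁-1}, and τ′ sends the letter of Uᵢ to the letters of that block. For τ′ to depend
-- on the letter only, each letter of the block is found by a bounded search for the least c with
-- φ(c) equal to the factor; the bound is a pigeonhole count, as distinct unbordered prefixes of x
-- have distinct lengths.

module Submission where

open import Data.Empty using (⊥; ⊥-elim)
open import Data.Fin using (Fin)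
import Data.Fin as Fin
import Data.Fin.Properties as Finₚ
open import Data.List using (List; []; _∷_; _++_; [_]; length; map; concat; applyUpTo; upTo; filter)
open import Data.List.NonEmpty using (List⁺; _∷_; toList)
open import Data.List.Properties hiding (sum-++)
open import Data.List.Relation.Unary.All using (All)
import Data.List.Relation.Unary.All.Properties as All
import Data.List.Relation.Unary.Any.Properties as Any
open import Data.Maybe using (Maybe; just; nothing; fromMaybe)
open import Data.Nat
open import Data.Nat.Induction using (<-rec)
open import Data.Nat.ListAction using (sum)
open import Data.Nat.ListAction.Properties using (sum-++)
open import Data.Nat.Properties
open import Data.Product using (Σ; _×_; _,_; proj₁; proj₂; ∃; ∃-syntax)
open import Data.Sum using (inj₁; inj₂)
open import Data.Unit using (⊤; tt)
open import Function using (_∘_; id)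
open import Relation.Binary.Definitions using (DecidableEquality; tri<; tri≈; tri>)
open import Relation.Binary.PropositionalEquality hiding ([_])
open import Relation.Nullary
open import Relation.Nullary.Decidable using (_×-dec_)
open import Relation.Unary using (Decidable)
open import Defs

module _ {A : Set} where

  applyUpTo-cong : ∀ n {f g : ℕ → A} → (∀ {j} → j < n → f j ≡ g j) →
                   applyUpTo f n ≡ applyUpTo g n
  applyUpTo-cong zero    eq = refl
  applyUpTo-cong (suc n) eq = cong₂ _∷_ (eq z<s) (applyUpTo-cong n (eq ∘ s<s))

  applyUpTo-cong⁻ : ∀ n {f g : ℕ → A} → applyUpTo f n ≡ applyUpTo g n →
                    ∀ {j} → j < n → f j ≡ g j
  applyUpTo-cong⁻ (suc n) eq {zero}  _         = ∷-injectiveˡ eq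
  applyUpTo-cong⁻ (suc n) eq {suc j} (s<s j<n) = applyUpTo-cong⁻ n (∷-injectiveʳ eq) j<n

  applyUpTo-≢[] : ∀ {n} (f : ℕ → A) → 0 < n → applyUpTo f n ≢ []
  applyUpTo-≢[] {suc n} f _ ()

  applyUpTo-+ : ∀ m n (f : ℕ → A) →
                applyUpTo f (m + n) ≡ applyUpTo f m ++ applyUpTo (f ∘ (m +_)) n
  applyUpTo-+ zero    n f = refl
  applyUpTo-+ (suc m) n f = cong (f 0 ∷_) (applyUpTo-+ m n (f ∘ suc))

  ≡applyUpTo⇒≡applyUpTo-length : ∀ {w : List A} {f n} → w ≡ applyUpTo f n →
                                  w ≡ applyUpTo f (length w)
  ≡applyUpTo⇒≡applyUpTo-length {f = f} {n} refl = cong (applyUpTo f) (sym (length-applyUpTo f n))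

  ++≡applyUpTo⇒prefix : ∀ u {v : List A} {f n} → u ++ v ≡ applyUpTo f n →
                        u ≡ applyUpTo f (length u)
  ++≡applyUpTo⇒prefix []      eq = refl
  ++≡applyUpTo⇒prefix (a ∷ u) {n = suc n} eq =
    cong₂ _∷_ (∷-injectiveˡ eq) (++≡applyUpTo⇒prefix u (∷-injectiveʳ eq))

  ++≡applyUpTo⇒suffix : ∀ u {v : List A} {f n} → u ++ v ≡ applyUpTo f n →
                        v ≡ applyUpTo (f ∘ (length u +_)) (length v)
  ++≡applyUpTo⇒suffix []      eq = ≡applyUpTo⇒≡applyUpTo-length eq
  ++≡applyUpTo⇒suffix (a ∷ u) {n = suc n} eq = ++≡applyUpTo⇒suffix u (∷-injectiveʳ eq)

  applyUpTo⇒IsPrefix : ∀ {w : List A} {f n} → w ≡ applyUpTo f n → IsPrefix w f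
  applyUpTo⇒IsPrefix {w} {f} eq = trans (≡applyUpTo⇒≡applyUpTo-length eq) (sym (map-upTo f (length w)))

module _ {P : ℕ → Set} (P? : Decidable P) where

  IsLeast : ℕ → Set
  IsLeast d = P d × (∀ {c} → c < d → ¬ P c)

  least : ∀ {n} → P n → ∃[ d ] d ≤ n × IsLeast d
  least {n} = <-rec (λ n → P n → ∃[ d ] d ≤ n × IsLeast d) step n
    where
    step : ∀ n → (∀ {m} → m < n → P m → ∃[ d ] d ≤ m × IsLeast d) → P n → ∃[ d ] d ≤ n × IsLeast d
    step n rec pn with anyUpTo? P? n
    ... | yes (m , m<n , pm) = let d , d≤m , dLeast = rec m<n pm in d , ≤-trans d≤m (<⇒≤ m<n) , dLeast
    ... | no  none           = n , ≤-refl , pn , λ c<n pc → none (_ , c<n , pc)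

  least-unique : ∀ {d e} → IsLeast d → IsLeast e → d ≡ e
  least-unique {d} {e} (pd , dLeast) (pe , eLeast) with <-cmp d e
  ... | tri< d<e _ _ = ⊥-elim (eLeast d<e pd)
  ... | tri≈ _ d≡e _ = d≡e
  ... | tri> _ _ e<d = ⊥-elim (dLeast e<d pe)

  leastBelow : ℕ → Maybe ℕ
  leastBelow b with anyUpTo? P? b
  ... | yes (_ , _ , pc) = just (proj₁ (least pc))
  ... | no  _            = nothing

  leastBelow-IsLeast : ∀ {b d} → d < b → IsLeast d → leastBelow b ≡ just d
  leastBelow-IsLeast {b} {d} d<b dLeast with anyUpTo? P? b
  ... | yes (_ , _ , pc) = cong just (least-unique (proj₂ (proj₂ (least pc))) dLeast)
  ... | no  none         = ⊥-elim (none (d , d<b , proj₁ dLeast))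

module PrefixOccurrences {A : Set} (x : ℕ → A) where

  OccursAt : ℕ → ℕ → Set
  OccursAt q l = ∀ {j} → j < l → x (q + j) ≡ x j

  UnborderedAt : ℕ → ℕ → Set
  UnborderedAt q l = OccursAt q l × Unbordered (applyUpTo x l)

  unbordered⇒0< : ∀ {l} → Unbordered (applyUpTo x l) → 0 < l
  unbordered⇒0< {zero}  (nonEmpty , _) = ⊥-elim (nonEmpty refl)
  unbordered⇒0< {suc l} _              = z<s

  overlap-border : ∀ {p c l k} → UnborderedAt p (c + l) → 0 < c → 0 < l →
                   OccursAt (p + c) k → l ≤ k → ⊥
  overlap-border {p} {c} {l} (occ , _ , unbordered) 0<c 0<l occ′ l≤k =
    unbordered (applyUpTo x l) (applyUpTo-≢[] x 0<l) shorter
      (applyUpTo (x ∘ (l +_)) c , asPrefix) (applyUpTo x c , asSuffix)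
    where
    shorter : applyUpTo x l ≢ applyUpTo x (c + l)
    shorter eq = <⇒≢ (m<n+m l 0<c)
      (trans (sym (length-applyUpTo x l)) (trans (cong length eq) (length-applyUpTo x (c + l))))
    asPrefix : applyUpTo x l ++ applyUpTo (x ∘ (l +_)) c ≡ applyUpTo x (c + l)
    asPrefix = trans (sym (applyUpTo-+ l c x)) (cong (applyUpTo x) (+-comm l c))
    tail≡prefix : ∀ {j} → j < l → x (c + j) ≡ x j
    tail≡prefix {j} j<l =
      trans (sym (occ (+-monoʳ-< c j<l)))
            (trans (cong x (sym (+-assoc p c j))) (occ′ (<-≤-trans j<l l≤k)))
    asSuffix : applyUpTo x c ++ applyUpTo x l ≡ applyUpTo x (c + l)
    asSuffix = trans (cong (applyUpTo x c ++_) (sym (applyUpTo-cong l tail≡prefix)))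
                     (sym (applyUpTo-+ c l x))

  occurrence-inside-unbordered : ∀ {p n s k} → UnborderedAt p n → p < s → s < p + n →
                                 OccursAt s k → p + n ≤ s + k → ⊥
  occurrence-inside-unbordered {p} {n} {k = k} up p<s s<p+n occ p+n≤s+k
    with m≤n⇒∃[o]m+o≡n (<⇒≤ p<s)
  ... | c , refl with m≤n⇒∃[o]m+o≡n (<⇒≤ (+-cancelˡ-< p c n s<p+n))
  ...   | l , refl = overlap-border up 0<c 0<l occ l≤k
    where
    0<c : 0 < c
    0<c = +-cancelˡ-< p 0 c (subst (_< p + c) (sym (+-identityʳ p)) p<s)
    0<l : 0 < l
    0<l = +-cancelˡ-< (p + c) 0 l
            (subst₂ _<_ (sym (+-identityʳ (p + c))) (sym (+-assoc p c l)) s<p+n)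
    l≤k : l ≤ k
    l≤k = +-cancelˡ-≤ (p + c) l k (subst (_≤ p + c + k) (sym (+-assoc p c l)) p+n≤s+k)

  Covered : ℕ → Set
  Covered g = ∀ e → g < e → ∃[ h ] g ≤ h × h < e × ∃[ k ] OccursAt h k × e ≤ h + k

  UnborderedTiling : (ℕ → Set) → Set
  UnborderedTiling S = ∀ {g} → S g → ∃[ l ] UnborderedAt g l × S (g + l)

  tiling⇒covered : ∀ {S} → UnborderedTiling S → ∀ {g} → S g → Covered g
  tiling⇒covered {S} tiling {g} sg e g<e = cover e sg g<e (m≤n+m e g)
    where
    cover : ∀ fuel {g} → S g → g < e → e ≤ g + fuel →
            ∃[ h ] g ≤ h × h < e × ∃[ k ] OccursAt h k × e ≤ h + k
    cover zero {g} _ g<e e≤g+0 = ⊥-elim (<⇒≱ g<e (subst (e ≤_) (+-identityʳ g) e≤g+0))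
    cover (suc fuel) {g} sg g<e e≤ with tiling sg
    ... | l , (occ , unb) , sg+l with e ≤? g + l
    ...   | yes e≤g+l = g , ≤-refl , g<e , l , occ , e≤g+l
    ...   | no  e≰g+l with cover fuel sg+l (≰⇒> e≰g+l) e≤g+l+fuel
      where
      e≤g+l+fuel : e ≤ g + l + fuel
      e≤g+l+fuel = ≤-trans e≤ (≤-trans (+-monoʳ-≤ g (+-monoˡ-≤ fuel (unbordered⇒0< unb)))
                                       (≤-reflexive (sym (+-assoc g l fuel))))
    ...     | h , g+l≤h , rest = h , ≤-trans (m≤m+n g l) g+l≤h , rest

  shorter-tile-absurd : ∀ {q l₁ l₂} → UnborderedAt q l₁ → UnborderedAt q l₂ → l₁ < l₂ →
                        Covered (q + l₁) → ⊥
  shorter-tile-absurd {q} {l₁} {l₂} (_ , unb₁) up₂ l₁<l₂ cov with cov (q + l₂) (+-monoʳ-< q l₁<l₂)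
  ... | h , q+l₁≤h , h<q+l₂ , k , occ , q+l₂≤h+k =
    occurrence-inside-unbordered up₂ (<-≤-trans (m<m+n q (unbordered⇒0< unb₁)) q+l₁≤h)
      h<q+l₂ occ q+l₂≤h+k

  unborderedTile-unique : ∀ {q l₁ l₂} → UnborderedAt q l₁ → UnborderedAt q l₂ →
                          Covered (q + l₁) → Covered (q + l₂) → l₁ ≡ l₂
  unborderedTile-unique {q} {l₁} {l₂} up₁ up₂ cov₁ cov₂ with <-cmp l₁ l₂
  ... | tri< l₁<l₂ _ _ = ⊥-elim (shorter-tile-absurd up₁ up₂ l₁<l₂ cov₁)
  ... | tri≈ _ l₁≡l₂ _ = l₁≡l₂
  ... | tri> _ _ l₂<l₁ = ⊥-elim (shorter-tile-absurd up₂ up₁ l₂<l₁ cov₂)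

  UnborderedChain : ℕ → List ℕ → Set
  UnborderedChain q []       = ⊤
  UnborderedChain q (l ∷ ls) = UnborderedAt q l × UnborderedChain (q + l) ls

  chain-∷ʳ : ∀ q ls {l} → UnborderedChain q ls → UnborderedAt (q + sum ls) l →
             UnborderedChain q (ls ++ [ l ])
  chain-∷ʳ q []       {l} _        up = subst (λ r → UnborderedAt r l) (+-identityʳ q) up , tt
  chain-∷ʳ q (a ∷ as) {l} (u , ch) up =
    u , chain-∷ʳ (q + a) as ch (subst (λ r → UnborderedAt r l) (sym (+-assoc q a (sum as))) up)

  chain-split : ∀ q as {l} bs → UnborderedChain q (as ++ l ∷ bs) →
                UnborderedAt (q + sum as) l × UnborderedChain (q + sum as + l) bs
  chain-split q []       {l} bs (u , ch) =
    subst (λ r → UnborderedAt r l) (sym (+-identityʳ q)) u ,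
    subst (λ r → UnborderedChain (r + l) bs) (sym (+-identityʳ q)) ch
  chain-split q (a ∷ as) {l} bs (_ , ch) =
    let u , ch′ = chain-split (q + a) as bs ch in
    subst (λ r → UnborderedAt r l) (+-assoc q a (sum as)) u ,
    subst (λ r → UnborderedChain (r + l) bs) (+-assoc q a (sum as)) ch′

  chain-shift : ∀ {q n} s ls → UnborderedChain s ls → s + sum ls ≤ n → OccursAt q n →
                UnborderedChain (q + s) ls
  chain-shift s []       _                _     _    = tt
  chain-shift {q} {n} s (l ∷ ls) ((occ , unb) , ch) inside occQ =
    (shifted , unb) ,
    subst (λ r → UnborderedChain r ls) (sym (+-assoc q s l))
      (chain-shift (s + l) ls ch inside′ occQ)
    where
    inside′ : s + l + sum ls ≤ n
    inside′ = ≤-trans (≤-reflexive (+-assoc s l (sum ls))) inside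
    s+l≤n : s + l ≤ n
    s+l≤n = ≤-trans (m≤m+n (s + l) (sum ls)) inside′
    shifted : OccursAt (q + s) l
    shifted {j} j<l =
      trans (cong x (+-assoc q s j)) (trans (occQ (<-≤-trans (+-monoʳ-< s j<l) s+l≤n)) (occ j<l))

  module _ (_≟_ : DecidableEquality A) where

    IsBorderLength : ℕ → ℕ → Set
    IsBorderLength n l = 0 < l × OccursAt (n ∸ l) l

    isBorderLength? : ∀ n → Decidable (IsBorderLength n)
    isBorderLength? n l = 0 <? l ×-dec allUpTo? (λ j → x (n ∸ l + j) ≟ x j) l

    shortestBorder-unbordered : ∀ {n b} → b ≤ n → IsLeast (isBorderLength? n) b →
                                Unbordered (applyUpTo x b)
    shortestBorder-unbordered {n} {b} b≤n ((0<b , occ) , shortest) = applyUpTo-≢[] x 0<b , noBorder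
      where
      noBorder : ∀ u → u ≢ [] → u ≢ applyUpTo x b → (∃ λ v → u ++ v ≡ applyUpTo x b) →
                 (∃ λ v → v ++ u ≡ applyUpTo x b) → ⊥
      noBorder u u≢[] u≢w (v , uv≡w) (v′ , v′u≡w) = shortest l<b (0<l u≢[] , occurs)
        where
        l o : ℕ
        l = length u
        o = length v′
        u≡prefix : u ≡ applyUpTo x l
        u≡prefix = ++≡applyUpTo⇒prefix u uv≡w
        u≡factor : u ≡ applyUpTo (x ∘ (o +_)) l
        u≡factor = ++≡applyUpTo⇒suffix v′ v′u≡w
        o+l≡b : o + l ≡ b
        o+l≡b = trans (sym (length-++ v′)) (trans (cong length v′u≡w) (length-applyUpTo x b))
        l<b : l < b
        l<b = ≤∧≢⇒< (subst (l ≤_) o+l≡b (m≤n+m l o))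
                    (λ l≡b → u≢w (trans u≡prefix (cong (applyUpTo x) l≡b)))
        0<l : ∀ {w : List A} → w ≢ [] → 0 < length w
        0<l {[]}    w≢[] = ⊥-elim (w≢[] refl)
        0<l {_ ∷ _} _    = z<s
        n∸l≡n∸b+o : n ∸ l ≡ n ∸ b + o
        n∸l≡n∸b+o = begin
          n ∸ l
            ≡⟨ cong (_∸ l) (sym (m∸n+n≡m b≤n)) ⟩
          n ∸ b + b ∸ l
            ≡⟨ cong (λ r → n ∸ b + r ∸ l) (sym o+l≡b) ⟩
          n ∸ b + (o + l) ∸ l
            ≡⟨ cong (_∸ l) (sym (+-assoc (n ∸ b) o l)) ⟩
          n ∸ b + o + l ∸ l
            ≡⟨ m+n∸n≡m (n ∸ b + o) l ⟩
          n ∸ b + o ∎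
          where open ≡-Reasoning
        occurs : OccursAt (n ∸ l) l
        occurs {j} j<l = begin
          x (n ∸ l + j)
            ≡⟨ cong (λ r → x (r + j)) n∸l≡n∸b+o ⟩
          x (n ∸ b + o + j)
            ≡⟨ cong x (+-assoc (n ∸ b) o j) ⟩
          x (n ∸ b + (o + j))
            ≡⟨ occ (subst (o + j <_) o+l≡b (+-monoʳ-< o j<l)) ⟩
          x (o + j)
            ≡⟨ applyUpTo-cong⁻ l (trans (sym u≡factor) u≡prefix) j<l ⟩
          x j ∎
          where open ≡-Reasoning

    isBorderLength-self : ∀ n → 0 < n → IsBorderLength n n
    isBorderLength-self n 0<n = 0<n , λ {j} _ → cong (λ r → x (r + j)) (n∸n≡0 n)

    -- The shortest border is unbordered; split it off at the right end and recurse.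
    -- Abstract, since unfolding the well-founded recursion makes type checking blow up.
    abstract
      unborderedFactorization : ∀ n → ∃[ ls ] UnborderedChain 0 ls × sum ls ≡ n
      unborderedFactorization = <-rec _ step
        where
        step : ∀ n → (∀ {m} → m < n → ∃[ ls ] UnborderedChain 0 ls × sum ls ≡ m) →
               ∃[ ls ] UnborderedChain 0 ls × sum ls ≡ n
        step zero    _   = [] , tt , refl
        step (suc n) rec with least (isBorderLength? (suc n)) (isBorderLength-self (suc n) z<s)
        ... | b , b≤ , bLeast@((0<b , occ) , _) with rec (∸-monoʳ-< 0<b b≤)
        ...   | ls , ch , Σls≡ =
          ls ++ [ b ] ,
          chain-∷ʳ 0 ls ch (subst (λ r → UnborderedAt r b) (sym Σls≡)
                                  (occ , shortestBorder-unbordered b≤ bLeast)) ,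
          trans (sum-++ ls [ b ]) (trans (cong₂ _+_ Σls≡ (+-identityʳ b)) (m∸n+n≡m b≤))

module DerivedWord {m} (U : ℕ → List⁺ (Fin m)) where

  word : ℕ → List (Fin m)
  word i = toList (U i)

  firstFrom-least : ∀ {w d} n (f : ℕ → ℕ) {j} → j < n → word (f j) ≡ toList w →
                    ∃[ k ] k ≤ j × firstFrom U w d (applyUpTo f n) ≡ f k ×
                           IsLeast (λ k → eqW (U (f k)) w) k
  firstFrom-least {w} (suc n) f {j} j<1+n match with eqW (U (f 0)) w | j
  ... | yes first | _     = 0 , z≤n , refl , first , λ ()
  ... | no  miss  | zero  = ⊥-elim (miss match)
  ... | no  miss  | suc j =
    let k , k≤j , found , kLeast = firstFrom-least n (f ∘ suc) (≤-pred j<1+n) match in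
    suc k , s≤s k≤j , found , proj₁ kLeast ,
    λ { {zero} _ → miss ; {suc c} c<k → proj₂ kLeast (≤-pred c<k) }

  firstOcc-least : ∀ i → firstOcc U i ≤ i × IsLeast (λ j → eqW (U j) (U i)) (firstOcc U i)
  firstOcc-least i with firstFrom-least {U i} {i} (suc i) id ≤-refl refl
  ... | k , k≤i , found , kLeast rewrite found = k≤i , kLeast

  firstOcc-sameWord : ∀ i → word (firstOcc U i) ≡ word i
  firstOcc-sameWord i = proj₁ (proj₂ (firstOcc-least i))

  firstOcc-cong : ∀ {i j} → word i ≡ word j → firstOcc U i ≡ firstOcc U j
  firstOcc-cong {i} {j} eq =
    least-unique (λ k → eqW (U k) (U j)) (trans (firstOcc-sameWord i) eq , earlier)
                 (proj₂ (firstOcc-least j))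
    where
    earlier : ∀ {c} → c < firstOcc U i → word c ≢ word j
    earlier c<fo same = proj₂ (proj₂ (firstOcc-least i)) c<fo (trans same (sym eq))

  firstOcc-new : ∀ i → IsNew U (firstOcc U i)
  firstOcc-new i earlier =
    let k , k<fo , same = Any.applyUpTo⁻ id earlier in
    proj₂ (proj₂ (firstOcc-least i)) k<fo (trans same (firstOcc-sameWord i))

  new⇒firstOcc≡ : ∀ {s} → IsNew U s → firstOcc U s ≡ s
  new⇒firstOcc≡ {s} new with m≤n⇒m<n∨m≡n (proj₁ (firstOcc-least s))
  ... | inj₁ fo<s = ⊥-elim (new (Any.applyUpTo⁺ id (firstOcc-sameWord s) fo<s))
  ... | inj₂ fo≡s = fo≡s

  new-injective : ∀ {s t} → IsNew U s → IsNew U t → word s ≡ word t → s ≡ t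
  new-injective ns nt eq = trans (sym (new⇒firstOcc≡ ns)) (trans (firstOcc-cong eq) (new⇒firstOcc≡ nt))

  countNew : ℕ → ℕ
  countNew n = length (filter (isNew? U) (upTo n))

  derived-cong : ∀ {i j} → word i ≡ word j → derived U i ≡ derived U j
  derived-cong eq = cong countNew (firstOcc-cong eq)

  derived-new : ∀ {s} → IsNew U s → derived U s ≡ countNew s
  derived-new ns = cong countNew (new⇒firstOcc≡ ns)

  countNew-suc : ∀ n → countNew (suc n) ≡ countNew n + length (filter (isNew? U) [ n ])
  countNew-suc n = begin
    length (filter (isNew? U) (upTo (suc n)))
      ≡⟨ cong (length ∘ filter (isNew? U)) (sym (upTo-∷ʳ n)) ⟩
    length (filter (isNew? U) (upTo n ++ [ n ]))
      ≡⟨ cong length (filter-++ (isNew? U) (upTo n) [ n ]) ⟩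
    length (filter (isNew? U) (upTo n) ++ filter (isNew? U) [ n ])
      ≡⟨ length-++ (filter (isNew? U) (upTo n)) ⟩
    countNew n + length (filter (isNew? U) [ n ]) ∎
    where open ≡-Reasoning

  countNew-new : ∀ {n} → IsNew U n → countNew (suc n) ≡ suc (countNew n)
  countNew-new {n} new =
    trans (countNew-suc n) (trans (cong (λ r → countNew n + length r) (filter-accept (isNew? U) new))
                                  (+-comm (countNew n) 1))

  countNew-old : ∀ {n} → ¬ IsNew U n → countNew (suc n) ≡ countNew n
  countNew-old {n} old =
    trans (countNew-suc n) (trans (cong (λ r → countNew n + length r) (filter-reject (isNew? U) old))
                                  (+-identityʳ (countNew n)))

  countNew-≤-suc : ∀ n → countNew n ≤ countNew (suc n)
  countNew-≤-suc n with isNew? U n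
  ... | yes new = ≤-trans (n≤1+n _) (≤-reflexive (sym (countNew-new new)))
  ... | no  old = ≤-reflexive (sym (countNew-old old))

  countNew-mono : ∀ {i j} → i ≤ j → countNew i ≤ countNew j
  countNew-mono {j = zero}  z≤n = ≤-refl
  countNew-mono {j = suc j} i≤1+j with m≤n⇒m<n∨m≡n i≤1+j
  ... | inj₁ i<1+j = ≤-trans (countNew-mono (≤-pred i<1+j)) (countNew-≤-suc j)
  ... | inj₂ refl  = ≤-refl

  countNew-< : ∀ {s n} → IsNew U s → s < n → countNew s < countNew n
  countNew-< ns s<n = ≤-trans (≤-reflexive (sym (countNew-new ns))) (countNew-mono s<n)

  countNew-preimage : ∀ n {c} → c < countNew n → ∃[ s ] s < n × IsNew U s × countNew s ≡ c
  countNew-preimage (suc n) {c} c<count with isNew? U n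
  ... | no old =
    let s , s<n , ns , eq = countNew-preimage n (subst (c <_) (countNew-old old) c<count) in
    s , m<n⇒m<1+n s<n , ns , eq
  ... | yes new with m≤n⇒m<n∨m≡n (≤-pred (subst (c <_) (countNew-new new) c<count))
  ...   | inj₂ c≡count = n , ≤-refl , new , sym c≡count
  ...   | inj₁ c<count′ =
    let s , s<n , ns , eq = countNew-preimage n c<count′ in s , m<n⇒m<1+n s<n , ns , eq

  countNew-≤ : ∀ {M L} (h : ℕ → ℕ) → (∀ {s} → s < M → IsNew U s → h s ≤ L) →
               (∀ {s t} → IsNew U s → IsNew U t → h s ≡ h t → s ≡ t) → countNew M ≤ suc L
  countNew-≤ {M} {L} h bounded injective = Finₚ.injective⇒≤ code-injective
    where
    preimage : (i : Fin (countNew M)) → ∃[ s ] s < M × IsNew U s × countNew s ≡ Fin.toℕ i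
    preimage i = countNew-preimage M (Finₚ.toℕ<n i)
    newAt : Fin (countNew M) → ℕ
    newAt i = proj₁ (preimage i)
    newAt-new : ∀ i → IsNew U (newAt i)
    newAt-new i = proj₁ (proj₂ (proj₂ (preimage i)))
    code : Fin (countNew M) → Fin (suc L)
    code i = Fin.fromℕ< (s≤s (bounded (proj₁ (proj₂ (preimage i))) (newAt-new i)))
    code-injective : ∀ {i j} → code i ≡ code j → i ≡ j
    code-injective {i} {j} eq = Finₚ.toℕ-injective (begin
      Fin.toℕ i
        ≡⟨ proj₂ (proj₂ (proj₂ (preimage i))) ⟨
      countNew (newAt i)
        ≡⟨ cong countNew (injective (newAt-new i) (newAt-new j) sameCode) ⟩
      countNew (newAt j)
        ≡⟨ proj₂ (proj₂ (proj₂ (preimage j))) ⟩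
      Fin.toℕ j ∎)
      where
      open ≡-Reasoning
      sameCode : h (newAt i) ≡ h (newAt j)
      sameCode = trans (sym (Finₚ.toℕ-fromℕ< _)) (trans (cong Fin.toℕ eq) (Finₚ.toℕ-fromℕ< _))

module FixedPointFactorization {m} (x : InfWord (Fin m)) (τ : Fin m → List⁺ (Fin m))
                               (fixed : IsFixedPoint τ x)
                               (U : ℕ → List⁺ (Fin m)) (isUP : IsUPFactorization x U) where

  open PrefixOccurrences x
  open DerivedWord U using (word)

  ℓ : ℕ → ℕ
  ℓ i = length (word i)

  start : ℕ → ℕ
  start i = length (cat U i)

  cat-U : ∀ i → cat U i ≡ applyUpTo x (start i)
  cat-U i = trans (proj₁ isUP i) (map-upTo x (start i))

  start-suc : ∀ i → start (suc i) ≡ start i + ℓ i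
  start-suc i = length-++ (cat U i)

  word-at-start : ∀ i → word i ≡ applyUpTo (x ∘ (start i +_)) (ℓ i)
  word-at-start i = ++-cancelˡ (applyUpTo x (start i)) _ _ (begin
    applyUpTo x (start i) ++ word i
      ≡⟨ cong (_++ word i) (cat-U i) ⟨
    cat U (suc i)
      ≡⟨ cat-U (suc i) ⟩
    applyUpTo x (start (suc i))
      ≡⟨ cong (applyUpTo x) (start-suc i) ⟩
    applyUpTo x (start i + ℓ i)
      ≡⟨ applyUpTo-+ (start i) (ℓ i) x ⟩
    applyUpTo x (start i) ++ applyUpTo (x ∘ (start i +_)) (ℓ i) ∎)
    where open ≡-Reasoning

  word-prefix : ∀ i → word i ≡ applyUpTo x (ℓ i)
  word-prefix i = trans (proj₁ (proj₂ isUP i)) (map-upTo x (ℓ i))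

  U-unborderedAt : ∀ i → UnborderedAt (start i) (ℓ i)
  U-unborderedAt i =
    applyUpTo-cong⁻ (ℓ i) {x ∘ (start i +_)} {x} (trans (sym (word-at-start i)) (word-prefix i)) ,
    subst Unbordered (word-prefix i) (proj₂ (proj₂ isUP i))

  start-mono : ∀ {i j} → i ≤ j → start i ≤ start j
  start-mono {j = zero}  z≤n = ≤-refl
  start-mono {j = suc j} i≤1+j with m≤n⇒m<n∨m≡n i≤1+j
  ... | inj₁ i<1+j = ≤-trans (start-mono (≤-pred i<1+j))
                             (≤-trans (m≤m+n (start j) (ℓ j)) (≤-reflexive (sym (start-suc j))))
  ... | inj₂ refl  = ≤-refl

  IsStart : ℕ → Set
  IsStart g = ∃[ a ] start a ≡ g

  starts-tiling : UnborderedTiling IsStart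
  starts-tiling (a , refl) = ℓ a , U-unborderedAt a , suc a , start-suc a

  T : ℕ → List⁺ (Fin m)
  T i = τ (x i)

  τstart : ℕ → ℕ
  τstart n = length (cat T n)

  cat-T : ∀ n → cat T n ≡ applyUpTo x (τstart n)
  cat-T n = trans (fixed n) (map-upTo x (τstart n))

  τ* : List (Fin m) → List (Fin m)
  τ* = applyM τ

  τ*-++ : ∀ u v → τ* (u ++ v) ≡ τ* u ++ τ* v
  τ*-++ = concatMap-++ (λ a → toList (τ a))

  cat-T-+ : ∀ p n → cat T (p + n) ≡ cat T p ++ τ* (applyUpTo (x ∘ (p +_)) n)
  cat-T-+ p zero = trans (cong (cat T) (+-identityʳ p)) (sym (++-identityʳ (cat T p)))
  cat-T-+ p (suc n) = begin
    cat T (p + suc n)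
      ≡⟨ cong (cat T) (+-suc p n) ⟩
    cat T (p + n) ++ toList (T (p + n))
      ≡⟨ cong (_++ toList (T (p + n))) (cat-T-+ p n) ⟩
    (cat T p ++ τ* (applyUpTo y n)) ++ toList (T (p + n))
      ≡⟨ ++-assoc (cat T p) _ _ ⟩
    cat T p ++ (τ* (applyUpTo y n) ++ toList (T (p + n)))
      ≡⟨ cong (λ w → cat T p ++ (τ* (applyUpTo y n) ++ w)) (++-identityʳ _) ⟨
    cat T p ++ (τ* (applyUpTo y n) ++ τ* [ y n ])
      ≡⟨ cong (cat T p ++_) (τ*-++ (applyUpTo y n) [ y n ]) ⟨
    cat T p ++ τ* (applyUpTo y n ++ [ y n ])
      ≡⟨ cong (λ w → cat T p ++ τ* w) (applyUpTo-∷ʳ y n) ⟩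
    cat T p ++ τ* (applyUpTo y (suc n)) ∎
    where
    open ≡-Reasoning
    y : ℕ → Fin m
    y = x ∘ (p +_)

  imageStart : ℕ → ℕ
  imageStart i = τstart (start i)

  imageLength : ℕ → ℕ
  imageLength i = length (τ* (word i))

  cat-T-start-suc : ∀ i → cat T (start (suc i)) ≡ cat T (start i) ++ τ* (word i)
  cat-T-start-suc i = begin
    cat T (start (suc i))
      ≡⟨ cong (cat T) (start-suc i) ⟩
    cat T (start i + ℓ i)
      ≡⟨ cat-T-+ (start i) (ℓ i) ⟩
    cat T (start i) ++ τ* (applyUpTo (x ∘ (start i +_)) (ℓ i))
      ≡⟨ cong (λ w → cat T (start i) ++ τ* w) (word-at-start i) ⟨
    cat T (start i) ++ τ* (word i) ∎
    where open ≡-Reasoning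

  imageStart-suc : ∀ i → imageStart (suc i) ≡ imageStart i + imageLength i
  imageStart-suc i = trans (cong length (cat-T-start-suc i)) (length-++ (cat T (start i)))

  image-at-imageStart : ∀ i → τ* (word i) ≡ applyUpTo (x ∘ (imageStart i +_)) (imageLength i)
  image-at-imageStart i = ++-cancelˡ (applyUpTo x (imageStart i)) _ _ (begin
    applyUpTo x (imageStart i) ++ τ* (word i)
      ≡⟨ cong (_++ τ* (word i)) (cat-T (start i)) ⟨
    cat T (start i) ++ τ* (word i)
      ≡⟨ cat-T-start-suc i ⟨
    cat T (start (suc i))
      ≡⟨ cat-T (start (suc i)) ⟩
    applyUpTo x (imageStart (suc i))
      ≡⟨ cong (applyUpTo x) (imageStart-suc i) ⟩
    applyUpTo x (imageStart i + imageLength i)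
      ≡⟨ applyUpTo-+ (imageStart i) (imageLength i) x ⟩
    applyUpTo x (imageStart i) ++ applyUpTo (x ∘ (imageStart i +_)) (imageLength i) ∎)
    where open ≡-Reasoning

  τ*-prefix : ∀ n → τ* (applyUpTo x n) ≡ applyUpTo x (length (τ* (applyUpTo x n)))
  τ*-prefix n = ≡applyUpTo⇒≡applyUpTo-length (trans (sym (cat-T-+ 0 n)) (cat-T n))

  image-prefix : ∀ i → τ* (word i) ≡ applyUpTo x (imageLength i)
  image-prefix i = subst (λ w → τ* w ≡ applyUpTo x (length (τ* w))) (sym (word-prefix i)) (τ*-prefix (ℓ i))

  image-occurs : ∀ i → OccursAt (imageStart i) (imageLength i)
  image-occurs i = applyUpTo-cong⁻ (imageLength i) {x ∘ (imageStart i +_)} {x}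
                                   (trans (sym (image-at-imageStart i)) (image-prefix i))

  factorLengths : ℕ → List ℕ
  factorLengths n = proj₁ (unborderedFactorization Fin._≟_ n)

  factorLengths-chain : ∀ n → UnborderedChain 0 (factorLengths n)
  factorLengths-chain n = proj₁ (proj₂ (unborderedFactorization Fin._≟_ n))

  sum-factorLengths : ∀ n → sum (factorLengths n) ≡ n
  sum-factorLengths n = proj₂ (proj₂ (unborderedFactorization Fin._≟_ n))

  imageFactors : ℕ → List ℕ
  imageFactors i = factorLengths (imageLength i)

  sum-imageFactors : ∀ i → sum (imageFactors i) ≡ imageLength i
  sum-imageFactors i = sum-factorLengths (imageLength i)

  image-chain : ∀ i → UnborderedChain (imageStart i) (imageFactors i)
  image-chain i =
    subst (λ q → UnborderedChain q (imageFactors i)) (+-identityʳ (imageStart i))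
      (chain-shift 0 (imageFactors i) (factorLengths-chain (imageLength i))
                   (≤-reflexive (sum-imageFactors i)) (image-occurs i))

  imageFactors-≢[] : ∀ i → imageFactors i ≢ []
  imageFactors-≢[] i eq = <⇒≢ z<s (trans (sym (cong sum eq)) (sum-imageFactors i))

  IsImageCut : ℕ → Set
  IsImageCut g = ∃[ i ] ∃[ as ] ∃[ bs ] as ++ bs ≡ imageFactors i × g ≡ imageStart i + sum as

  image-tile : ∀ i as {l} bs → as ++ l ∷ bs ≡ imageFactors i →
               UnborderedAt (imageStart i + sum as) l × IsImageCut (imageStart i + sum as + l)
  image-tile i as {l} bs eq =
    proj₁ (chain-split (imageStart i) as bs (subst (UnborderedChain (imageStart i)) (sym eq) (image-chain i))) ,
    i , as ++ [ l ] , bs , trans (++-assoc as [ l ] bs) eq ,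
    trans (+-assoc (imageStart i) (sum as) l)
          (cong (imageStart i +_) (trans (cong (sum as +_) (sym (+-identityʳ l))) (sym (sum-++ as [ l ]))))

  image-tiling : UnborderedTiling IsImageCut
  image-tiling (i , as , l ∷ bs , eq , refl) = l , image-tile i as bs eq
  image-tiling (i , as , [] , eq , refl) with imageFactors (suc i) in eqF
  ... | []     = ⊥-elim (imageFactors-≢[] (suc i) eqF)
  ... | l ∷ bs = l , subst (λ g → UnborderedAt g l × IsImageCut (g + l)) nextBlock
                           (image-tile (suc i) [] bs (sym eqF))
    where
    nextBlock : imageStart (suc i) + 0 ≡ imageStart i + sum as
    nextBlock = begin
      imageStart (suc i) + 0
        ≡⟨ +-identityʳ _ ⟩
      imageStart (suc i)
        ≡⟨ imageStart-suc i ⟩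
      imageStart i + imageLength i
        ≡⟨ cong (imageStart i +_) (sum-imageFactors i) ⟨
      imageStart i + sum (imageFactors i)
        ≡⟨ cong (λ w → imageStart i + sum w) (trans (sym eq) (++-identityʳ as)) ⟩
      imageStart i + sum as ∎
      where open ≡-Reasoning

  -- both factorizations tile x by unbordered prefixes, so they cut at the same places
  align : ∀ ls {q a} → start a ≡ q → UnborderedChain q ls →
          (∀ as bs → as ++ bs ≡ ls → Covered (q + sum as)) →
          applyUpTo (ℓ ∘ (a +_)) (length ls) ≡ ls × start (a + length ls) ≡ q + sum ls
  align []       {q} {a} refl _ _ = refl , trans (cong start (+-identityʳ a)) (sym (+-identityʳ q))
  align (l ∷ ls) {q} {a} refl (up , chain) covered =
    cong₂ _∷_ (trans (cong ℓ (+-identityʳ a)) ℓa≡l) (trans shift (proj₁ rest)) ,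
    trans (cong start (+-suc a (length ls))) (trans (proj₂ rest) (+-assoc q l (sum ls)))
    where
    ℓa≡l : ℓ a ≡ l
    ℓa≡l = unborderedTile-unique (U-unborderedAt a) up
             (tiling⇒covered starts-tiling (suc a , start-suc a))
             (subst Covered (cong (q +_) (+-identityʳ l)) (covered [ l ] ls refl))
    rest : applyUpTo (ℓ ∘ (suc a +_)) (length ls) ≡ ls × start (suc a + length ls) ≡ q + l + sum ls
    rest = align ls (trans (start-suc a) (cong (q +_) ℓa≡l)) chain
             (λ as bs eq → subst Covered (sym (+-assoc q l (sum as))) (covered (l ∷ as) bs (cong (l ∷_) eq)))
    shift : applyUpTo (ℓ ∘ (a +_) ∘ suc) (length ls) ≡ applyUpTo (ℓ ∘ (suc a +_)) (length ls)
    shift = applyUpTo-cong (length ls) (λ {j} _ → cong ℓ (+-suc a j))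

  blockStart : ℕ → ℕ
  blockStart zero    = 0
  blockStart (suc i) = blockStart i + length (imageFactors i)

  image-covered : ∀ i as bs → as ++ bs ≡ imageFactors i → Covered (imageStart i + sum as)
  image-covered i as bs eq = tiling⇒covered image-tiling (i , as , bs , eq , refl)

  start-blockStart : ∀ i → start (blockStart i) ≡ imageStart i
  start-blockStart zero    = refl
  start-blockStart (suc i) = begin
    start (blockStart i + length (imageFactors i))
      ≡⟨ proj₂ (align (imageFactors i) {a = blockStart i} (start-blockStart i)
        (image-chain i) (image-covered i)) ⟩
    imageStart i + sum (imageFactors i)
      ≡⟨ cong (imageStart i +_) (sum-imageFactors i) ⟩
    imageStart i + imageLength i
      ≡⟨ imageStart-suc i ⟨
    imageStart (suc i) ∎
    where open ≡-Reasoning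

  block-lengths : ∀ i → applyUpTo (ℓ ∘ (blockStart i +_)) (length (imageFactors i)) ≡ imageFactors i
  block-lengths i =
    proj₁ (align (imageFactors i) {a = blockStart i} (start-blockStart i) (image-chain i) (image-covered i))

  cat-U-+ : ∀ a n → cat U (a + n) ≡ cat U a ++ concat (applyUpTo (word ∘ (a +_)) n)
  cat-U-+ a zero    = trans (cong (cat U) (+-identityʳ a)) (sym (++-identityʳ (cat U a)))
  cat-U-+ a (suc n) = begin
    cat U (a + suc n)
      ≡⟨ cong (cat U) (+-suc a n) ⟩
    cat U (a + n) ++ word (a + n)
      ≡⟨ cong (_++ word (a + n)) (cat-U-+ a n) ⟩
    (cat U a ++ concat (applyUpTo w n)) ++ w n
      ≡⟨ ++-assoc (cat U a) _ _ ⟩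
    cat U a ++ (concat (applyUpTo w n) ++ w n)
      ≡⟨ cong (λ v → cat U a ++ (concat (applyUpTo w n) ++ v)) (++-identityʳ (w n)) ⟨
    cat U a ++ (concat (applyUpTo w n) ++ concat [ w n ])
      ≡⟨ cong (cat U a ++_) (concat-++ (applyUpTo w n) [ w n ]) ⟩
    cat U a ++ concat (applyUpTo w n ++ [ w n ])
      ≡⟨ cong (λ v → cat U a ++ concat v) (applyUpTo-∷ʳ w n) ⟩
    cat U a ++ concat (applyUpTo w (suc n)) ∎
    where
    open ≡-Reasoning
    w : ℕ → List (Fin m)
    w = word ∘ (a +_)

  block-words : ∀ t → concat (applyUpTo (word ∘ (blockStart t +_)) (length (imageFactors t))) ≡ τ* (word t)
  block-words t = trans (++-cancelˡ (applyUpTo x (imageStart t)) _ _ (begin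
    applyUpTo x (imageStart t) ++ concat B
      ≡⟨ cong (λ q → applyUpTo x q ++ concat B) (start-blockStart t) ⟨
    applyUpTo x (start (blockStart t)) ++ concat B
      ≡⟨ cong (_++ concat B) (cat-U (blockStart t)) ⟨
    cat U (blockStart t) ++ concat B
      ≡⟨ cat-U-+ (blockStart t) (length (imageFactors t)) ⟨
    cat U (blockStart (suc t))
      ≡⟨ cat-U (blockStart (suc t)) ⟩
    applyUpTo x (start (blockStart (suc t)))
      ≡⟨ cong (applyUpTo x) (start-blockStart (suc t)) ⟩
    applyUpTo x (imageStart (suc t))
      ≡⟨ cong (applyUpTo x) (imageStart-suc t) ⟩
    applyUpTo x (imageStart t + imageLength t)
      ≡⟨ applyUpTo-+ (imageStart t) (imageLength t) x ⟩
    applyUpTo x (imageStart t) ++ applyUpTo (x ∘ (imageStart t +_)) (imageLength t) ∎))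
    (sym (image-at-imageStart t))
    where
    open ≡-Reasoning
    B : List (List (Fin m))
    B = applyUpTo (word ∘ (blockStart t +_)) (length (imageFactors t))

-- the empty list, which never occurs below, is sent to [ 0 ]
fromList⁰ : List ℕ → List⁺ ℕ
fromList⁰ []       = 0 ∷ []
fromList⁰ (a ∷ as) = a ∷ as

toList-fromList⁰-map : ∀ (f : ℕ → ℕ) {l} → l ≢ [] → toList (fromList⁰ (map f l)) ≡ map f l
toList-fromList⁰-map f {[]}    l≢[] = ⊥-elim (l≢[] refl)
toList-fromList⁰-map f {_ ∷ _} _    = refl

module Conjugacy {m} (x : InfWord (Fin m)) (τ : Fin m → List⁺ (Fin m)) (fixed : IsFixedPoint τ x)
                 (U : ℕ → List⁺ (Fin m)) (isUP : IsUPFactorization x U)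
                 (φ : ℕ → List⁺ (Fin m)) (φ-derived : ∀ i → φ (derived U i) ≡ U i) where

  open DerivedWord U
  open FixedPointFactorization x τ fixed U isUP

  δ : ℕ → ℕ
  δ = derived U

  φ-δ : ∀ i → toList (φ (δ i)) ≡ word i
  φ-δ i = cong toList (φ-derived i)

  letterImageLength : ℕ → ℕ
  letterImageLength k = length (τ* (toList (φ k)))

  letterImageLength-δ : ∀ i → letterImageLength (δ i) ≡ imageLength i
  letterImageLength-δ i = cong (length ∘ τ*) (φ-δ i)

  imageLengthBound : ℕ → ℕ
  imageLengthBound zero    = letterImageLength 0
  imageLengthBound (suc k) = imageLengthBound k + letterImageLength (suc k)

  ≤-imageLengthBound : ∀ {c k} → c ≤ k → letterImageLength c ≤ imageLengthBound k
  ≤-imageLengthBound {k = zero}  z≤n = ≤-refl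
  ≤-imageLengthBound {k = suc k} c≤1+k with m≤n⇒m<n∨m≡n c≤1+k
  ... | inj₁ c<1+k = ≤-trans (≤-imageLengthBound (≤-pred c<1+k)) (m≤m+n _ _)
  ... | inj₂ refl  = m≤n+m _ _

  blockContaining : ∀ F {s} → s < blockStart (suc F) →
                    ∃[ t ] t ≤ F × blockStart t ≤ s × s < blockStart (suc t)
  blockContaining zero    s<end = 0 , z≤n , z≤n , s<end
  blockContaining (suc F) {s} s<end with blockStart (suc F) ≤? s
  ... | yes begin≤s = suc F , ≤-refl , begin≤s , s<end
  ... | no  begin≰s = let t , t≤F , inBlock = blockContaining F (≰⇒> begin≰s) in
                      t , m≤n⇒m≤1+n t≤F , inBlock

  ℓ≤imageLength : ∀ {t s} → blockStart t ≤ s → s < blockStart (suc t) → ℓ s ≤ imageLength t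
  ℓ≤imageLength {t} {s} begin≤s s<end =
    +-cancelˡ-≤ (imageStart t) _ _ (≤-trans (+-monoˡ-≤ (ℓ s) imageStart≤start) end≤end)
    where
    imageStart≤start : imageStart t ≤ start s
    imageStart≤start = subst (_≤ start s) (start-blockStart t) (start-mono begin≤s)
    end≤end : start s + ℓ s ≤ imageStart t + imageLength t
    end≤end = subst₂ _≤_ (start-suc s) (trans (start-blockStart (suc t)) (imageStart-suc t)) (start-mono s<end)

  δ≤δ-new : ∀ {t F} → IsNew U F → t ≤ F → δ t ≤ δ F
  δ≤δ-new {t} nF t≤F =
    ≤-trans (countNew-mono (≤-trans (proj₁ (firstOcc-least t)) t≤F)) (≤-reflexive (sym (derived-new nF)))

  ℓ-injective : ∀ {s t} → ℓ s ≡ ℓ t → word s ≡ word t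
  ℓ-injective {s} {t} eq = trans (word-prefix s) (trans (cong (applyUpTo x) eq) (sym (word-prefix t)))

  -- distinct factors up to the block of F are distinct prefixes, all shorter than some τ(φ c) with c ≤ δ F
  countNew-blockStart : ∀ {F} → IsNew U F → countNew (blockStart (suc F)) ≤ suc (imageLengthBound (δ F))
  countNew-blockStart {F} nF = countNew-≤ ℓ bounded (λ ns nt eq → new-injective ns nt (ℓ-injective eq))
    where
    bounded : ∀ {s} → s < blockStart (suc F) → IsNew U s → ℓ s ≤ imageLengthBound (δ F)
    bounded s<end _ =
      let t , t≤F , begin≤s , s<end′ = blockContaining F s<end in
      ≤-trans (ℓ≤imageLength begin≤s s<end′)
              (subst (_≤ imageLengthBound (δ F)) (letterImageLength-δ t) (≤-imageLengthBound (δ≤δ-new nF t≤F)))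

  IsPrefixLetter : ℕ → ℕ → Set
  IsPrefixLetter l c = toList (φ c) ≡ applyUpTo x l

  isPrefixLetter? : ∀ l → Decidable (IsPrefixLetter l)
  isPrefixLetter? l c = ≡-dec Fin._≟_ (toList (φ c)) (applyUpTo x l)

  letterFor : ℕ → ℕ → ℕ
  letterFor k l = fromMaybe 0 (leastBelow (isPrefixLetter? l) (suc (imageLengthBound k)))

  τ′ : ℕ → List⁺ ℕ
  τ′ k = fromList⁰ (map (letterFor k) (factorLengths (letterImageLength k)))

  δ-least : ∀ j → IsLeast (isPrefixLetter? (ℓ j)) (δ j)
  δ-least j = trans (φ-δ j) (word-prefix j) , earlier
    where
    -- the letters below δ j are the values of δ before the first occurrence of U j, naming other words
    earlier : ∀ {c} → c < δ j → ¬ IsPrefixLetter (ℓ j) c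
    earlier c<δj prefix =
      let s , _ , ns , countS≡c = countNew-preimage (firstOcc U j) c<δj
          δs≡c = trans (derived-new ns) countS≡c
          sameWord = trans (sym (φ-δ s)) (trans (cong (toList ∘ φ) δs≡c) (trans prefix (sym (word-prefix j))))
      in <⇒≢ c<δj (trans (sym δs≡c) (derived-cong sameWord))

  -- the same factor recurs in the block of the first occurrence F of U t, where the bound applies
  δ-block-bound : ∀ t {r} → r < length (imageFactors t) → δ (blockStart t + r) < suc (imageLengthBound (δ t))
  δ-block-bound t {r} r<len = begin-strict
    δ (blockStart t + r)
      ≡⟨ derived-cong (ℓ-injective sameLengths) ⟩
    δ (blockStart F + r)
      <⟨ countNew-< (firstOcc-new (blockStart F + r)) (≤-<-trans (proj₁ (firstOcc-least _)) inBlockF) ⟩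
    countNew (blockStart (suc F))
      ≤⟨ countNew-blockStart (firstOcc-new t) ⟩
    suc (imageLengthBound (δ F))
      ≡⟨ cong (suc ∘ imageLengthBound) (derived-cong (firstOcc-sameWord t)) ⟩
    suc (imageLengthBound (δ t)) ∎
    where
    open ≤-Reasoning
    F : ℕ
    F = firstOcc U t
    sameFactors : imageFactors F ≡ imageFactors t
    sameFactors = cong (factorLengths ∘ length ∘ τ*) (firstOcc-sameWord t)
    sameLengths : ℓ (blockStart t + r) ≡ ℓ (blockStart F + r)
    sameLengths = applyUpTo-cong⁻ (length (imageFactors t)) {ℓ ∘ (blockStart t +_)} {ℓ ∘ (blockStart F +_)}
      (trans (block-lengths t) (sym (subst (λ fs → applyUpTo (ℓ ∘ (blockStart F +_)) (length fs) ≡ fs)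
                                           sameFactors (block-lengths F))))
      r<len
    inBlockF : blockStart F + r < blockStart (suc F)
    inBlockF = +-monoʳ-< (blockStart F) (subst (r <_) (cong length (sym sameFactors)) r<len)

  letterFor-δ : ∀ t {r} → r < length (imageFactors t) →
                letterFor (δ t) (ℓ (blockStart t + r)) ≡ δ (blockStart t + r)
  letterFor-δ t r<len =
    cong (fromMaybe 0) (leastBelow-IsLeast (isPrefixLetter? _) (δ-block-bound t r<len) (δ-least _))

  τ′-δ : ∀ t → toList (τ′ (δ t)) ≡ applyUpTo (δ ∘ (blockStart t +_)) (length (imageFactors t))
  τ′-δ t = begin
    toList (τ′ (δ t))
      ≡⟨ toList-fromList⁰-map (letterFor (δ t)) factors≢[] ⟩
    map (letterFor (δ t)) (factorLengths (letterImageLength (δ t)))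
      ≡⟨ cong (map (letterFor (δ t)) ∘ factorLengths) (letterImageLength-δ t) ⟩
    map (letterFor (δ t)) (imageFactors t)
      ≡⟨ cong (map (letterFor (δ t))) (block-lengths t) ⟨
    map (letterFor (δ t)) (applyUpTo (ℓ ∘ (blockStart t +_)) L)
      ≡⟨ map-applyUpTo _ (letterFor (δ t)) L ⟩
    applyUpTo (letterFor (δ t) ∘ ℓ ∘ (blockStart t +_)) L
      ≡⟨ applyUpTo-cong L (letterFor-δ t) ⟩
    applyUpTo (δ ∘ (blockStart t +_)) L ∎
    where
    open ≡-Reasoning
    L : ℕ
    L = length (imageFactors t)
    factors≢[] : factorLengths (letterImageLength (δ t)) ≢ []
    factors≢[] = subst (λ n → factorLengths n ≢ []) (sym (letterImageLength-δ t)) (imageFactors-≢[] t)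

  τ′-closed : ∀ k → InDerivedAlphabet δ k → All (InDerivedAlphabet δ) (toList (τ′ k))
  τ′-closed _ (t , refl) =
    subst (All (InDerivedAlphabet δ)) (sym (τ′-δ t)) (All.applyUpTo⁺₂ _ _ (λ r → blockStart t + r , refl))

  cat-τ′-δ : ∀ i → cat (τ′ ∘ δ) i ≡ applyUpTo δ (blockStart i)
  cat-τ′-δ zero    = refl
  cat-τ′-δ (suc i) = trans (cong₂ _++_ (cat-τ′-δ i) (τ′-δ i)) (sym (applyUpTo-+ (blockStart i) _ δ))

  δ-fixed : IsFixedPoint τ′ δ
  δ-fixed n = applyUpTo⇒IsPrefix (cat-τ′-δ n)

  conjugacy : ∀ k → InDerivedAlphabet δ k → applyM φ (toList (τ′ k)) ≡ applyM τ (toList (φ k))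
  conjugacy _ (t , refl) = begin
    applyM φ (toList (τ′ (δ t)))
      ≡⟨ cong (applyM φ) (τ′-δ t) ⟩
    concat (map (toList ∘ φ) (applyUpTo (δ ∘ (blockStart t +_)) L))
      ≡⟨ cong concat (map-applyUpTo _ (toList ∘ φ) L) ⟩
    concat (applyUpTo (toList ∘ φ ∘ δ ∘ (blockStart t +_)) L)
      ≡⟨ cong concat (applyUpTo-cong L (λ _ → φ-δ _)) ⟩
    concat (applyUpTo (word ∘ (blockStart t +_)) L)
      ≡⟨ block-words t ⟩
    τ* (word t)
      ≡⟨ cong τ* (φ-δ t) ⟨
    applyM τ (toList (φ (δ t))) ∎
    where
    open ≡-Reasoning
    L : ℕ
    L = length (imageFactors t)

mainTheorem11 : (m : ℕ) (x : InfWord (Fin m)) (τ : Fin m → List⁺ (Fin m)) →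
    InP1 x → IsFixedPoint τ x →
    (U : ℕ → List⁺ (Fin m)) → IsUPFactorization x U →
    (φ : ℕ → List⁺ (Fin m)) → (∀ i → φ (derived U i) ≡ U i) →
    Σ (ℕ → List⁺ ℕ) λ τ' →
      (∀ k → InDerivedAlphabet (derived U) k →
         All (InDerivedAlphabet (derived U)) (toList (τ' k))) ×
      IsFixedPoint τ' (derived U) ×
      (∀ k → InDerivedAlphabet (derived U) k →
         applyM φ (toList (τ' k)) ≡ applyM τ (toList (φ k)))
mainTheorem11 m x τ _ fixed U isUP φ φ-derived = τ′ , τ′-closed , δ-fixed , conjugacy
  where open Conjugacy x τ fixed U isUP φ φ-derived
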